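{- Let $G$ be a connected graph such that every dual mutual-visibility set of $G$ is independent. Then for every edge $uv\in E(G)$ at least one of the following holds: (a) $u$ or $v$ is the middle vertex of a convex $P_3$; (b) $uv$ is the middle edge of a convex diamond.
   Context: All graphs are finite and simple. For $X\subseteq V(G)$, two vertices $u,v$ are $X$-visible if there is a shortest $u,v$-path $P$ with $V(P)\cap X\subseteq\{u,v\}$; $X$ is a dual mutual-visibility set if any two vertices of $X$ are $X$-visible and any two vertices of $V(G)\setminus X$ are $X$-visible. A convex $P_3$ is a path $xyz$ with $xz\notin E(G)$ and $N(x)\cap N(z)=\{y\}$; $y$ is its middle vertex. A convex diamond $v_1v_2v_3v_4$ is a subgraph isomorphic to $K_4$ minus an edge in which $v_1,v_3$ are nonadjacent and $N(v_1)\cap N(v_3)=\{v_2,v_4\}$; $v_2v_4$ is its middle edge. -}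

module Defs where

open import Data.Nat using (ℕ; zero; suc; _≤_)
open import Data.Fin using (Fin)
open import Data.Bool using (Bool; true; false)
open import Data.List using (List; []; _∷_)
open import Data.List.Membership.Propositional using (_∈_)
open import Data.Product using (Σ; ∃; ∃-syntax; _×_)
open import Data.Sum using (_⊎_)
open import Relation.Nullary using (¬_)
open import Relation.Binary.PropositionalEquality using (_≡_; _≢_)

record Graph : Set where
  field
    n     : ℕ
    adj   : Fin n → Fin n → Bool
    sym   : ∀ u v → adj u v ≡ adj v u
    irref : ∀ u → adj u u ≡ false

module _ (G : Graph) where
  open Graph G

  V : Set
  V = Fin n

  E : V → V → Set
  E u v = adj u v ≡ true

  data Walk : V → V → Set where
    nil  : ∀ {u} → Walk u u
    cons : ∀ {u w v} → E u w → Walk w v → Walk u v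

  len : ∀ {u v} → Walk u v → ℕ
  len nil        = zero
  len (cons _ p) = suc (len p)

  verts : ∀ {u v} → Walk u v → List V
  verts {u} nil        = u ∷ []
  verts {u} (cons _ p) = u ∷ verts p

  Connected : Set
  Connected = ∀ u v → Walk u v

  -- a shortest u,v-path: a u,v-walk of minimum length (necessarily a path)
  Shortest : ∀ {u v} → Walk u v → Set
  Shortest {u} {v} p = ∀ (q : Walk u v) → len p ≤ len q

  VSet : Set
  VSet = V → Bool

  Visible : VSet → V → V → Set
  Visible X u v = Σ (Walk u v) λ p → Shortest p ×
    (∀ x → x ∈ verts p → X x ≡ true → (x ≡ u ⊎ x ≡ v))

  DualMutualVisibility : VSet → Set
  DualMutualVisibility X =
    (∀ u v → X u ≡ true → X v ≡ true → Visible X u v) ×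
    (∀ u v → X u ≡ false → X v ≡ false → Visible X u v)

  Independent : VSet → Set
  Independent X = ∀ u v → X u ≡ true → X v ≡ true → ¬ E u v

  MiddleOfConvexP3 : V → Set
  MiddleOfConvexP3 y = ∃[ x ] ∃[ z ]
    (x ≢ z × E x y × E y z × ¬ E x z ×
     (∀ w → E x w → E z w → w ≡ y))

  ConvexDiamond : V → V → V → V → Set
  ConvexDiamond v1 v2 v3 v4 =
    v1 ≢ v3 × E v1 v2 × E v2 v3 × E v3 v4 × E v4 v1 × E v2 v4 × ¬ E v1 v3 ×
    (∀ w → E v1 w → E v3 w → (w ≡ v2 ⊎ w ≡ v4))

  MiddleEdgeOfConvexDiamond : V → V → Set
  MiddleEdgeOfConvexDiamond u v = ∃[ a ] ∃[ b ] ConvexDiamond a u b v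

{-# OPTIONS --safe #-}
module Submission where

open import Defs
open import Data.Bool using (true; false) renaming (_≟_ to _≟ᵇ_)
open import Data.Bool.Properties using (not-¬; ¬-not)
open import Data.Empty using (⊥-elim)
open import Data.Fin using (_≟_)
open import Data.Fin.Properties using (any?; all?)
open import Data.List.Relation.Unary.All using (All; []; _∷_; lookup)
open import Data.List.Relation.Unary.Any using (here; there)
open import Data.Nat using (ℕ; zero; suc; pred; _≤_; _<_; z≤n; s≤s)
open import Data.Nat.Properties using (≤-refl; ≤-trans; n≤1+n; 1+n≰n; ≮⇒≥; m<1+n⇒m<n∨m≡n)
open import Data.Product using (Σ; ∃; ∃-syntax; _×_; _,_)
open import Data.Sum using (_⊎_; inj₁; inj₂; [_,_]′; swap)
open import Function using (_∘_)
open import Relation.Nullary using (¬_; Dec; yes; no; does)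
open import Relation.Nullary.Decidable using (_×-dec_; _→-dec_; _⊎-dec_; ¬?; dec-true)
open import Relation.Unary using (Pred; Decidable)
open import Relation.Binary.PropositionalEquality using (_≡_; _≢_; refl; sym; trans; cong; subst)

-- Take X = {u, v}. Two
-- vertices outside X are joined by a shortest path; whenever it runs through
-- u or v, as a - c - b with c ∈ {u, v}, the vertices a and b are at distance
-- two, so if neither (a) nor (b) holds they have a common neighbour outside
-- {u, v}, and replacing c by it keeps the path shortest. Hence X is a dual
-- mutual-visibility set containing an edge, against the hypothesis. Since (a)
-- and (b) are decidable on a finite graph, this contradiction proves them.

Minimal : ∀ {p} → Pred ℕ p → Pred ℕ p
Minimal P m = P m × (∀ {j} → j < m → ¬ P j)

module _ {p} {P : Pred ℕ p} (P? : Decidable P) where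

  minimal-or-none-below : ∀ k → ∃ (Minimal P) ⊎ (∀ {j} → j < k → ¬ P j)
  minimal-or-none-below zero = inj₂ λ ()
  minimal-or-none-below (suc k) with minimal-or-none-below k | P? k
  ... | inj₁ found | _      = inj₁ found
  ... | inj₂ none  | yes Pk = inj₁ (k , Pk , none)
  ... | inj₂ none  | no ¬Pk = inj₂ λ j<1+k → [ none , (λ { refl → ¬Pk }) ]′ (m<1+n⇒m<n∨m≡n j<1+k)

  minimal : ∀ {k} → P k → ∃ (Minimal P)
  minimal {k} Pk with minimal-or-none-below (suc k)
  ... | inj₁ found = found
  ... | inj₂ none  = ⊥-elim (none ≤-refl Pk)

module _ (G : Graph) where
  open Graph G using (adj; irref)

  E? : ∀ a b → Dec (E G a b)
  E? a b = adj a b ≟ᵇ true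

  E-sym : ∀ {a b} → E G a b → E G b a
  E-sym {a} {b} ab = trans (Graph.sym G b a) ab

  E-irrefl : ∀ {a} → ¬ E G a a
  E-irrefl {a} aa with trans (sym aa) (irref a)
  ... | ()

  Nonadjacent : V G → V G → Set
  Nonadjacent a b = a ≢ b × ¬ E G a b

  middleOfConvexP3? : ∀ y → Dec (MiddleOfConvexP3 G y)
  middleOfConvexP3? y =
    any? λ x → any? λ z →
      ¬? (x ≟ z) ×-dec E? x y ×-dec E? y z ×-dec ¬? (E? x z) ×-dec
      all? λ w → E? x w →-dec E? z w →-dec w ≟ y

  middleEdgeOfConvexDiamond? : ∀ u v → Dec (MiddleEdgeOfConvexDiamond G u v)
  middleEdgeOfConvexDiamond? u v =
    any? λ a → any? λ b →
      ¬? (a ≟ b) ×-dec E? a u ×-dec E? u b ×-dec E? b v ×-dec E? v a ×-dec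
      E? u v ×-dec ¬? (E? a b) ×-dec
      all? λ w → E? a w →-dec E? b w →-dec (w ≟ u ⊎-dec w ≟ v)

  middleEdgeOfConvexDiamond-sym : ∀ {u v} →
    MiddleEdgeOfConvexDiamond G u v → MiddleEdgeOfConvexDiamond G v u
  middleEdgeOfConvexDiamond-sym (a , b , a≢b , au , ub , bv , va , uv , a≁b , common) =
    a , b , a≢b , E-sym va , E-sym bv , E-sym ub , E-sym au , E-sym uv , a≁b ,
    λ w aw bw → swap (common w aw bw)

  convexP3-or-convexDiamond : ∀ {u v a b} → E G u v → Nonadjacent a b →
    E G a u → E G u b → (∀ w → E G a w → E G b w → w ≡ u ⊎ w ≡ v) →
    MiddleOfConvexP3 G u ⊎ MiddleEdgeOfConvexDiamond G u v
  convexP3-or-convexDiamond {u} {v} {a} {b} uv (a≢b , a≁b) au ub common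
    with E? a v ×-dec E? v b
  ... | yes (av , vb) =
    inj₂ (a , b , a≢b , au , ub , E-sym vb , E-sym av , uv , a≁b , common)
  ... | no ¬avb = inj₁ (a , b , a≢b , au , ub , a≁b , only-u)
    where
    only-u : ∀ w → E G a w → E G b w → w ≡ u
    only-u w aw bw with common w aw bw
    ... | inj₁ w≡u  = w≡u
    ... | inj₂ refl = ⊥-elim (¬avb (aw , E-sym bw))

  walk-of-length? : ∀ m x y → Dec (Σ (Walk G x y) λ p → len G p ≡ m)
  walk-of-length? zero x y with x ≟ y
  ... | yes refl = yes (nil , refl)
  ... | no x≢y   = no λ { (nil , _) → x≢y refl ; (cons _ _ , ()) }
  walk-of-length? (suc m) x y with any? (λ w → E? x w ×-dec walk-of-length? m w y)
  ... | yes (w , xw , p , len≡m) = yes (cons xw p , cong suc len≡m)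
  ... | no none = no λ { (nil , ())
                       ; (cons {w = w} xw p , len≡) → none (w , xw , p , cong pred len≡) }

  shortest-walk : ∀ {x y} → Walk G x y → Σ (Walk G x y) (Shortest G)
  shortest-walk {x} {y} p with minimal (λ m → walk-of-length? m x y) {len G p} (p , refl)
  ... | _ , (q , refl) , below = q , λ r → ≮⇒≥ λ r<q → below r<q (r , refl)

  Shortest-tail : ∀ {x w y} (e : E G x w) (p : Walk G w y) → Shortest G (cons e p) → Shortest G p
  Shortest-tail e _ sh r with sh (cons e r)
  ... | s≤s p≤r = p≤r

  Shortest⇒nonadjacent : ∀ {x w b y} (e : E G x w) (f : E G w b) (p : Walk G b y) →
    Shortest G (cons e (cons f p)) → Nonadjacent x b
  Shortest⇒nonadjacent _ _ p sh =
    (λ { refl → 1+n≰n (≤-trans (n≤1+n _) (sh p)) }) , λ xb → 1+n≰n (sh (cons xb p))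

  Outside : VSet G → V G → Set
  Outside X z = X z ≡ false

  Bypassable : VSet G → Set
  Bypassable X = ∀ {a b c} → Nonadjacent a b → E G a c → E G c b → X c ≡ true →
    ∃[ w ] E G a w × E G w b × Outside X w

  visible-refl : ∀ {X} a → Visible G X a a
  visible-refl a = nil , (λ _ → z≤n) , λ { _ (here refl) _ → inj₁ refl }

  visible-adjacent : ∀ {X a b} → E G a b → Visible G X a b
  visible-adjacent ab = cons ab nil , shortest , λ
    { _ (here refl) _ → inj₁ refl
    ; _ (there (here refl)) _ → inj₂ refl }
    where
    shortest : Shortest G (cons ab nil)
    shortest nil        = ⊥-elim (E-irrefl ab)
    shortest (cons _ _) = s≤s z≤n

  module _ (X : VSet G) (bypass : Bypassable X) where

    reroute : ∀ {x w y} → Outside X x → Outside X y →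
      (e : E G x w) (p : Walk G w y) → Shortest G (cons e p) →
      Σ (Walk G x y) λ q → len G q ≡ len G (cons e p) × All (Outside X) (verts G q)
    reroute x∉ y∉ e nil _ = cons e nil , refl , x∉ ∷ y∉ ∷ []
    reroute {w = w} x∉ y∉ e (cons f p) sh with X w in w-eq
    ... | false with reroute w-eq y∉ f p (Shortest-tail e (cons f p) sh)
    ...   | q , len≡ , q∉ = cons e q , cong suc len≡ , x∉ ∷ q∉
    reroute x∉ y∉ e (cons f p) sh | true with bypass (Shortest⇒nonadjacent e f p sh) e f w-eq
    ... | w′ , xw′ , w′b , w′∉
      -- the detour x - w′ - b has the same length, so sh is also its shortness proof
      with reroute w′∉ y∉ w′b p (Shortest-tail xw′ (cons w′b p) sh)
    ...   | q , len≡ , q∉ = cons xw′ q , cong suc len≡ , x∉ ∷ q∉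

    outside-visible : Connected G → ∀ a b → Outside X a → Outside X b → Visible G X a b
    outside-visible conn a b a∉ b∉ with shortest-walk (conn a b)
    ... | nil , _ = visible-refl a
    ... | cons e p , sh with reroute a∉ b∉ e p sh
    ...   | q , len≡ , q∉ =
      q , (λ r → subst (_≤ len G r) (sym len≡) (sh r)) ,
      λ z z∈q z∈X → ⊥-elim (not-¬ z∈X (lookup q∉ z∈q))

  pair : V G → V G → VSet G
  pair u v z = does (z ≟ u ⊎-dec z ≟ v)

  pair-true : ∀ u v z → pair u v z ≡ true → z ≡ u ⊎ z ≡ v
  pair-true u v z = witness (z ≟ u ⊎-dec z ≟ v)
    where
    witness : ∀ {A : Set} (a? : Dec A) → does a? ≡ true → A
    witness (yes a) _ = a
    witness (no _) ()

  pair-left : ∀ u v → pair u v u ≡ true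
  pair-left u v = dec-true (u ≟ u ⊎-dec u ≟ v) (inj₁ refl)

  pair-right : ∀ u v → pair u v v ≡ true
  pair-right u v = dec-true (v ≟ u ⊎-dec v ≟ v) (inj₂ refl)

  pair-bypassable : ∀ {u v} → E G u v →
    ¬ ((MiddleOfConvexP3 G u ⊎ MiddleOfConvexP3 G v) ⊎ MiddleEdgeOfConvexDiamond G u v) →
    Bypassable (pair u v)
  pair-bypassable {u} {v} uv ¬convex {a} {b} {c} a≁b ac cb c∈
    with any? (λ w → E? a w ×-dec E? w b ×-dec pair u v w ≟ᵇ false)
  ... | yes found = found
  ... | no none = ⊥-elim (¬convex (convex (pair-true u v c c∈)))
    where
    common : ∀ w → E G a w → E G b w → w ≡ u ⊎ w ≡ v
    common w aw bw = pair-true u v w (¬-not λ w∉ → none (w , aw , E-sym bw , w∉))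
    convex : c ≡ u ⊎ c ≡ v →
      (MiddleOfConvexP3 G u ⊎ MiddleOfConvexP3 G v) ⊎ MiddleEdgeOfConvexDiamond G u v
    convex (inj₁ refl) =
      [ inj₁ ∘ inj₁ , inj₂ ]′ (convexP3-or-convexDiamond uv a≁b ac cb common)
    convex (inj₂ refl) =
      [ inj₁ ∘ inj₂ , inj₂ ∘ middleEdgeOfConvexDiamond-sym ]′
        (convexP3-or-convexDiamond (E-sym uv) a≁b ac cb (λ w aw bw → swap (common w aw bw)))

  pair-dualMutualVisibility : ∀ {u v} → Connected G → E G u v → Bypassable (pair u v) →
    DualMutualVisibility G (pair u v)
  pair-dualMutualVisibility {u} {v} conn uv bypass = inside , outside-visible (pair u v) bypass conn
    where
    inside : ∀ a b → pair u v a ≡ true → pair u v b ≡ true → Visible G (pair u v) a b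
    inside a b a∈ b∈ with pair-true u v a a∈ | pair-true u v b b∈
    ... | inj₁ refl | inj₁ refl = visible-refl a
    ... | inj₂ refl | inj₂ refl = visible-refl a
    ... | inj₁ refl | inj₂ refl = visible-adjacent uv
    ... | inj₂ refl | inj₁ refl = visible-adjacent (E-sym uv)

corollary4p4 : (G : Graph) → Connected G →
    (∀ (X : VSet G) → DualMutualVisibility G X → Independent G X) →
    ∀ u v → E G u v →
    ((MiddleOfConvexP3 G u ⊎ MiddleOfConvexP3 G v) ⊎ MiddleEdgeOfConvexDiamond G u v)
corollary4p4 G conn independent u v uv
  with (middleOfConvexP3? G u ⊎-dec middleOfConvexP3? G v) ⊎-dec middleEdgeOfConvexDiamond? G u v
... | yes convex = convex
... | no ¬convex = ⊥-elim (independent (pair G u v) dmv u v (pair-left G u v) (pair-right G u v) uv)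
  where
  dmv : DualMutualVisibility G (pair G u v)
  dmv = pair-dualMutualVisibility G conn uv (pair-bypassable G uv ¬convex)
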